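{- (i) The graphs $\Delta_2$ and $\Delta_4$ are not JIS. (ii) The graphs $\Delta_3$ and $\Delta_5$ are JIS.
   Context: For $i \ge 2$, $\Delta_i$ is the graph on vertices $v_1,\dots,v_{i+3}$ with edges $v_jv_{j+1}$ for $1 \le j \le i+1$, $v_jv_{j+2}$ for $1 \le j \le i$, and the two edges $v_{i+3}v_1$ and $v_{i+3}v_{i+2}$; i.e., a chain of $i$ consecutively adjacent triangles $v_jv_{j+1}v_{j+2}$ plus one extra vertex joined to the two degree-2 vertices $v_1, v_{i+2}$ of the chain. A graph $G$ is called JIS if there exist a positive integer $n$ and an assignment of an $n$-element set $S_v$ to each vertex $v$ of $G$ such that distinct vertices receive distinct sets, and for distinct vertices $v,w$, $v$ and $w$ are adjacent iff $|S_v \cap S_w| = n-1$ (equivalently, $G$ is isomorphic to an induced subgraph of a Johnson graph). -}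

module Defs where

open import Data.Nat using (ℕ; suc; _+_; _∸_; _≤_; _<_)
open import Data.Fin using (Fin; toℕ)
open import Data.Fin.Subset using (Subset; ∣_∣; _∩_)
open import Data.Product using (Σ; _×_; ∃-syntax)
open import Data.Sum using (_⊎_)
open import Relation.Binary.PropositionalEquality using (_≡_)
open import Relation.Nullary using (¬_)

Graph : ℕ → Set₁
Graph k = Fin k → Fin k → Set

-- Directed edge list of Δ_i, with vertices v_1 … v_{i+3} encoded as 0 … i+2
-- (v_j ↦ j ∸ 1).
--   v_j v_{j+1}  (1 ≤ j ≤ i+1)  ↦  a , a+1  with a ≤ i
--   v_j v_{j+2}  (1 ≤ j ≤ i)    ↦  a , a+2  with a < i
--   v_{i+3} v_1                 ↦  i+2 , 0
--   v_{i+3} v_{i+2}             ↦  i+2 , i+1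
data ΔEdge (i : ℕ) : ℕ → ℕ → Set where
  step : ∀ a → a ≤ i → ΔEdge i a (suc a)
  skip : ∀ a → a < i → ΔEdge i a (suc (suc a))
  apex₁ : ΔEdge i (i + 2) 0
  apex₂ : ΔEdge i (i + 2) (i + 1)

Δ : (i : ℕ) → Graph (i + 3)
Δ i x y = ΔEdge i (toℕ x) (toℕ y) ⊎ ΔEdge i (toℕ y) (toℕ x)

-- G is JIS: there are a positive integer n and an assignment of n-element
-- sets S_v to the vertices (WLOG subsets of a finite ground set Fin m, since
-- only finitely many finite sets are involved) that is injective and such that
-- distinct v, w are adjacent iff |S_v ∩ S_w| = n - 1.
IsJIS : ∀ {k} → Graph k → Set
IsJIS {k} G =
  ∃[ n ] ∃[ m ] Σ (Fin k → Subset m) λ S →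
      (1 ≤ n)
    × (∀ v → ∣ S v ∣ ≡ n)
    × (∀ v w → S v ≡ S w → v ≡ w)
    × (∀ v w → ¬ v ≡ w → (G v w → ∣ S v ∩ S w ∣ ≡ n ∸ 1)
                       × (∣ S v ∩ S w ∣ ≡ n ∸ 1 → G v w))

module Submission where

-- In a JIS representation S by n-sets the asymmetric difference ∣ S v ─ S w ∣
-- is 1 on edges and at least 2 on distinct non-edges.  The spread of S along
-- a list of ordered pairs (the sum of these differences) is additive over the
-- points of the ground set, so an inequality between spreads that holds for
-- all families of subsets of a one-point set holds for all families (the cut
-- principle).  Hence G is not JIS once there are edges E, non-edges N and
-- edges R with spread (E ++ N) ≤ spread R on one-point families and
-- ∣R∣ < ∣E∣ + 2∣N∣, since then ∣E∣ + 2∣N∣ ≤ spread (E ++ N) ≤ spread R = ∣R∣.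
-- These cut conditions are decidable and are checked by evaluation for Δ₂
-- and Δ₄.  Adjacency in Δᵢ is decidable, hence so is being a representation
-- by an explicit family; the families for Δ₃ (2-subsets of a 5-set) and Δ₅
-- (3-subsets of a 6-set) are checked by evaluation.

open import Defs
open import Data.Product using (_×_)
open import Relation.Nullary using (¬_)

open import Algebra.Properties.CommutativeSemigroup using (interchange)
open import Data.Bool using (true; false)
open import Data.Bool.Properties using () renaming (_≟_ to _≟ᵇ_)
open import Data.Empty using (⊥-elim)
open import Data.Fin using (Fin; toℕ; #_) renaming (_≟_ to _≟ᶠ_)
open import Data.Fin.Properties using (all?)
open import Data.Fin.Subset using (Subset; ∣_∣; _∩_; _∪_; _─_; ⁅_⁆)
open import Data.Fin.Subset.Properties using (∩-comm)
open import Data.List using (List; []; _∷_; _++_; length)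
open import Data.List.Relation.Unary.All using (All; []; _∷_) renaming (all? to all?ᴸ)
open import Data.Nat using (ℕ; zero; suc; _+_; _*_; _∸_; _≤_; _<_; z≤n; s≤s; _≤?_; _<?_)
  renaming (_≟_ to _≟ⁿ_)
open import Data.Nat.Properties
  using (+-suc; +-comm; +-assoc; +-cancelˡ-≡; +-mono-≤; ≤-reflexive; <⇒≱; suc-injective;
         m+[n∸m]≡n; +-commutativeSemigroup; module ≤-Reasoning)
open import Data.Product using (_,_; proj₁; proj₂)
open import Data.Sum using (_⊎_; inj₁; inj₂)
open import Data.Vec using ([]; _∷_; head; tail; lookup; tabulate)
open import Data.Vec.Properties using (lookup∘tabulate; ≡-dec)
open import Function using (_∘_; _⇔_; mk⇔)
open import Relation.Binary.PropositionalEquality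
  using (_≡_; refl; sym; trans; cong; cong₂; module ≡-Reasoning)
open import Relation.Nullary.Decidable
  using (Dec; map; map′; from-yes; ¬?; _×-dec_; _⊎-dec_; _→-dec_)

∣p∣≡∣p∩q∣+∣p─q∣ : ∀ {m} (p q : Subset m) → ∣ p ∣ ≡ ∣ p ∩ q ∣ + ∣ p ─ q ∣
∣p∣≡∣p∩q∣+∣p─q∣ []          []          = refl
∣p∣≡∣p∩q∣+∣p─q∣ (true  ∷ p) (true  ∷ q) = cong suc (∣p∣≡∣p∩q∣+∣p─q∣ p q)
∣p∣≡∣p∩q∣+∣p─q∣ (true  ∷ p) (false ∷ q) =
  trans (cong suc (∣p∣≡∣p∩q∣+∣p─q∣ p q)) (sym (+-suc _ _))
∣p∣≡∣p∩q∣+∣p─q∣ (false ∷ p) (true  ∷ q) = ∣p∣≡∣p∩q∣+∣p─q∣ p q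
∣p∣≡∣p∩q∣+∣p─q∣ (false ∷ p) (false ∷ q) = ∣p∣≡∣p∩q∣+∣p─q∣ p q

∣p─q∣≡∣q─p∣ : ∀ {m} (p q : Subset m) → ∣ p ∣ ≡ ∣ q ∣ → ∣ p ─ q ∣ ≡ ∣ q ─ p ∣
∣p─q∣≡∣q─p∣ p q ∣p∣≡∣q∣ = +-cancelˡ-≡ ∣ p ∩ q ∣ _ _ (begin
  ∣ p ∩ q ∣ + ∣ p ─ q ∣  ≡⟨ sym (∣p∣≡∣p∩q∣+∣p─q∣ p q) ⟩
  ∣ p ∣                  ≡⟨ ∣p∣≡∣q∣ ⟩
  ∣ q ∣                  ≡⟨ ∣p∣≡∣p∩q∣+∣p─q∣ q p ⟩
  ∣ q ∩ p ∣ + ∣ q ─ p ∣  ≡⟨ cong (λ r → ∣ r ∣ + ∣ q ─ p ∣) (∩-comm q p) ⟩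
  ∣ p ∩ q ∣ + ∣ q ─ p ∣  ∎)
  where open ≡-Reasoning

─-empty⇒≡ : ∀ {m} (p q : Subset m) → ∣ p ─ q ∣ ≡ 0 → ∣ q ─ p ∣ ≡ 0 → p ≡ q
─-empty⇒≡ []          []          _  _  = refl
─-empty⇒≡ (true  ∷ p) (true  ∷ q) pq qp = cong (true ∷_) (─-empty⇒≡ p q pq qp)
─-empty⇒≡ (false ∷ p) (false ∷ q) pq qp = cong (false ∷_) (─-empty⇒≡ p q pq qp)
─-empty⇒≡ (true  ∷ p) (false ∷ q) () _
─-empty⇒≡ (false ∷ p) (true  ∷ q) _  ()

∣─∣-uncons : ∀ {m} (p q : Subset (suc m)) →
             ∣ p ─ q ∣ ≡ ∣ (head p ∷ []) ─ (head q ∷ []) ∣ + ∣ tail p ─ tail q ∣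
∣─∣-uncons (true  ∷ p) (true  ∷ q) = refl
∣─∣-uncons (true  ∷ p) (false ∷ q) = refl
∣─∣-uncons (false ∷ p) (true  ∷ q) = refl
∣─∣-uncons (false ∷ p) (false ∷ q) = refl

IsJohnsonRepresentation : ∀ {k m} → Graph k → ℕ → (Fin k → Subset m) → Set
IsJohnsonRepresentation G n S =
    (1 ≤ n)
  × (∀ v → ∣ S v ∣ ≡ n)
  × (∀ v w → S v ≡ S w → v ≡ w)
  × (∀ v w → ¬ v ≡ w → (G v w → ∣ S v ∩ S w ∣ ≡ n ∸ 1)
                     × (∣ S v ∩ S w ∣ ≡ n ∸ 1 → G v w))

IsEdge IsNonEdge : ∀ {k} → Graph k → Fin k × Fin k → Set
IsEdge    G (v , w) = ¬ v ≡ w × G v w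
IsNonEdge G (v , w) = ¬ v ≡ w × ¬ G v w

Pairs : ℕ → Set
Pairs k = List (Fin k × Fin k)

spread : ∀ {k m} → Pairs k → (Fin k → Subset m) → ℕ
spread []            S = 0
spread ((v , w) ∷ L) S = ∣ S v ─ S w ∣ + spread L S

spread-++ : ∀ {k m} (A B : Pairs k) (S : Fin k → Subset m) →
            spread (A ++ B) S ≡ spread A S + spread B S
spread-++ []            B S = refl
spread-++ ((v , w) ∷ A) B S =
  trans (cong (∣ S v ─ S w ∣ +_) (spread-++ A B S)) (sym (+-assoc ∣ S v ─ S w ∣ _ _))

module JohnsonDistance {k m} {G : Graph k} {n : ℕ} {S : Fin k → Subset m}
                       (rep : IsJohnsonRepresentation G n S) where

  open ≡-Reasoning

  private
    positive : 1 ≤ n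
    positive = proj₁ rep

    sized : ∀ v → ∣ S v ∣ ≡ n
    sized = proj₁ (proj₂ rep)

    injective : ∀ v w → S v ≡ S w → v ≡ w
    injective = proj₁ (proj₂ (proj₂ rep))

    adjacency : ∀ v w → ¬ v ≡ w → (G v w → ∣ S v ∩ S w ∣ ≡ n ∸ 1)
                                × (∣ S v ∩ S w ∣ ≡ n ∸ 1 → G v w)
    adjacency = proj₂ (proj₂ (proj₂ rep))

  overlap+distance : ∀ v w → suc (n ∸ 1) ≡ ∣ S v ∩ S w ∣ + ∣ S v ─ S w ∣
  overlap+distance v w = begin
    suc (n ∸ 1)                    ≡⟨ m+[n∸m]≡n positive ⟩
    n                              ≡⟨ sym (sized v) ⟩
    ∣ S v ∣                        ≡⟨ ∣p∣≡∣p∩q∣+∣p─q∣ (S v) (S w) ⟩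
    ∣ S v ∩ S w ∣ + ∣ S v ─ S w ∣  ∎

  edge⇒distance≡1 : ∀ {v w} → ¬ v ≡ w → G v w → ∣ S v ─ S w ∣ ≡ 1
  edge⇒distance≡1 {v} {w} v≢w vw = +-cancelˡ-≡ (n ∸ 1) _ _ (begin
    (n ∸ 1) + ∣ S v ─ S w ∣        ≡⟨ cong (_+ ∣ S v ─ S w ∣) (proj₁ (adjacency v w v≢w) vw) ⟨
    ∣ S v ∩ S w ∣ + ∣ S v ─ S w ∣  ≡⟨ overlap+distance v w ⟨
    suc (n ∸ 1)                    ≡⟨ +-comm 1 (n ∸ 1) ⟩
    (n ∸ 1) + 1                    ∎)

  distance≡1⇒edge : ∀ {v w} → ¬ v ≡ w → ∣ S v ─ S w ∣ ≡ 1 → G v w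
  distance≡1⇒edge {v} {w} v≢w d≡1 = proj₂ (adjacency v w v≢w) (sym (suc-injective (begin
    suc (n ∸ 1)                    ≡⟨ overlap+distance v w ⟩
    ∣ S v ∩ S w ∣ + ∣ S v ─ S w ∣  ≡⟨ cong (∣ S v ∩ S w ∣ +_) d≡1 ⟩
    ∣ S v ∩ S w ∣ + 1              ≡⟨ +-comm ∣ S v ∩ S w ∣ 1 ⟩
    suc ∣ S v ∩ S w ∣              ∎)))

  -- Distinct vertices carry distinct sets, which by equal size differ both ways.
  distinct⇒distance≢0 : ∀ {v w} → ¬ v ≡ w → ¬ ∣ S v ─ S w ∣ ≡ 0
  distinct⇒distance≢0 {v} {w} v≢w d≡0 = v≢w (injective v w
    (─-empty⇒≡ (S v) (S w) d≡0
      (trans (∣p─q∣≡∣q─p∣ (S w) (S v) (trans (sized w) (sym (sized v)))) d≡0)))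

  nonEdge⇒distance≥2 : ∀ {v w} → ¬ v ≡ w → ¬ G v w → 2 ≤ ∣ S v ─ S w ∣
  nonEdge⇒distance≥2 {v} {w} v≢w ¬vw with ∣ S v ─ S w ∣ in d
  ... | zero        = ⊥-elim (distinct⇒distance≢0 v≢w d)
  ... | suc zero    = ⊥-elim (¬vw (distance≡1⇒edge v≢w d))
  ... | suc (suc _) = s≤s (s≤s z≤n)

  spread-edges : ∀ {L} → All (IsEdge G) L → spread L S ≡ length L
  spread-edges []                 = refl
  spread-edges ((v≢w , vw) ∷ es) = cong₂ _+_ (edge⇒distance≡1 v≢w vw) (spread-edges es)

  spread-nonEdges : ∀ {L} → All (IsNonEdge G) L → length L * 2 ≤ spread L S
  spread-nonEdges []                  = z≤n
  spread-nonEdges ((v≢w , ¬vw) ∷ ns) =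
    +-mono-≤ (nonEdge⇒distance≥2 v≢w ¬vw) (spread-nonEdges ns)

column : ∀ {k} → Subset k → Fin k → Subset 1
column c v = lookup c v ∷ []

spread-empty : ∀ {k} (L : Pairs k) (S : Fin k → Subset 0) → spread L S ≡ 0
spread-empty []            S = refl
spread-empty ((v , w) ∷ L) S with S v | S w
... | [] | [] = spread-empty L S

spread-uncons : ∀ {k m} (L : Pairs k) (S : Fin k → Subset (suc m)) →
                spread L S ≡ spread L (column (tabulate (head ∘ S))) + spread L (tail ∘ S)
spread-uncons []            S = refl
spread-uncons ((v , w) ∷ L) S = begin
  ∣ S v ─ S w ∣ + spread L S
    ≡⟨ cong₂ _+_ (∣─∣-uncons (S v) (S w)) (spread-uncons L S) ⟩
  (∣ first v ─ first w ∣ + ∣ rest v ─ rest w ∣) + (spread L S₀ + spread L rest)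
    ≡⟨ interchange +-commutativeSemigroup ∣ first v ─ first w ∣ _ (spread L S₀) _ ⟩
  (∣ first v ─ first w ∣ + spread L S₀) + (∣ rest v ─ rest w ∣ + spread L rest)
    ≡⟨ cong₂ _+_ (cong (_+ spread L S₀) first≗S₀) refl ⟩
  (∣ S₀ v ─ S₀ w ∣ + spread L S₀) + (∣ rest v ─ rest w ∣ + spread L rest)
    ∎
  where
  open ≡-Reasoning

  first S₀ : Fin _ → Subset 1
  first u = head (S u) ∷ []
  S₀      = column (tabulate (head ∘ S))

  rest : Fin _ → Subset _
  rest = tail ∘ S

  first≗S₀ : ∣ first v ─ first w ∣ ≡ ∣ S₀ v ─ S₀ w ∣
  first≗S₀ = cong₂ (λ p q → ∣ p ─ q ∣) (cong (_∷ []) (sym (lookup∘tabulate (head ∘ S) v)))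
                                       (cong (_∷ []) (sym (lookup∘tabulate (head ∘ S) w)))

cut-principle : ∀ {k} (L R : Pairs k) →
                (∀ c → spread L (column c) ≤ spread R (column c)) →
                ∀ {m} (S : Fin k → Subset m) → spread L S ≤ spread R S
cut-principle L R cuts {zero}  S =
  ≤-reflexive (trans (spread-empty L S) (sym (spread-empty R S)))
cut-principle {k} L R cuts {suc m} S = begin
  spread L S                                  ≡⟨ spread-uncons L S ⟩
  spread L (column c₀) + spread L (tail ∘ S)  ≤⟨ +-mono-≤ (cuts c₀)
                                                          (cut-principle L R cuts (tail ∘ S)) ⟩
  spread R (column c₀) + spread R (tail ∘ S)  ≡⟨ spread-uncons R S ⟨
  spread R S                                  ∎
  where
  open ≤-Reasoning

  c₀ : Subset k
  c₀ = tabulate (head ∘ S)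

CutConditions : ∀ {k} → Graph k → (E N R : Pairs k) → Set
CutConditions G E N R =
    All (IsEdge G) E
  × All (IsNonEdge G) N
  × All (IsEdge G) R
  × (∀ c → spread (E ++ N) (column c) ≤ spread R (column c))
  × length R < length E + length N * 2

cutConditions⇒¬JIS : ∀ {k} {G : Graph k} (E N R : Pairs k) →
                     CutConditions G E N R → ¬ IsJIS G
cutConditions⇒¬JIS E N R (E-edges , N-nonEdges , R-edges , cuts , counting)
                         (n , m , S , rep) = <⇒≱ counting (begin
  length E + length N * 2  ≤⟨ +-mono-≤ (≤-reflexive (sym (spread-edges E-edges)))
                                        (spread-nonEdges N-nonEdges) ⟩
  spread E S + spread N S  ≡⟨ spread-++ E N S ⟨
  spread (E ++ N) S        ≤⟨ cut-principle (E ++ N) R cuts S ⟩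
  spread R S               ≡⟨ spread-edges R-edges ⟩
  length R                 ∎)
  where
  open JohnsonDistance rep
  open ≤-Reasoning

allSubsets? : ∀ {n} {P : Subset n → Set} → (∀ p → Dec (P p)) → Dec (∀ p → P p)
allSubsets? {zero}  P? = map′ (λ P[] → λ { [] → P[] }) (λ ∀P → ∀P []) (P? [])
allSubsets? {suc n} P? =
  map′ (λ (P-in , P-out) → λ { (true ∷ p) → P-in p ; (false ∷ p) → P-out p })
       (λ ∀P → (λ p → ∀P (true ∷ p)) , (λ p → ∀P (false ∷ p)))
       (allSubsets? (P? ∘ (true ∷_)) ×-dec allSubsets? (P? ∘ (false ∷_)))

DecidableGraph : ∀ {k} → Graph k → Set
DecidableGraph G = ∀ v w → Dec (G v w)

cutConditions? : ∀ {k} {G : Graph k} → DecidableGraph G →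
                 (E N R : Pairs k) → Dec (CutConditions G E N R)
cutConditions? {G = G} G? E N R =
       all?ᴸ isEdge? E
  ×-dec all?ᴸ isNonEdge? N
  ×-dec all?ᴸ isEdge? R
  ×-dec allSubsets? (λ c → spread (E ++ N) (column c) ≤? spread R (column c))
  ×-dec length R <? length E + length N * 2
  where
  isEdge? : ∀ e → Dec (IsEdge G e)
  isEdge? (v , w) = ¬? (v ≟ᶠ w) ×-dec G? v w

  isNonEdge? : ∀ e → Dec (IsNonEdge G e)
  isNonEdge? (v , w) = ¬? (v ≟ᶠ w) ×-dec ¬? (G? v w)

representation? : ∀ {k m} {G : Graph k} → DecidableGraph G →
                  ∀ n (S : Fin k → Subset m) → Dec (IsJohnsonRepresentation G n S)
representation? G? n S =
        1 ≤? n
  ×-dec all? (λ v → ∣ S v ∣ ≟ⁿ n)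
  ×-dec all? (λ v → all? (λ w → ≡-dec _≟ᵇ_ (S v) (S w) →-dec v ≟ᶠ w))
  ×-dec all? (λ v → all? (λ w →
          ¬? (v ≟ᶠ w) →-dec (G? v w →-dec ∣ S v ∩ S w ∣ ≟ⁿ n ∸ 1)
                       ×-dec (∣ S v ∩ S w ∣ ≟ⁿ n ∸ 1 →-dec G? v w)))

ΔEquations : ℕ → ℕ → ℕ → Set
ΔEquations i a b =
  ((b ≡ suc a × a ≤ i) ⊎ (b ≡ suc (suc a) × a < i)) ⊎
  ((a ≡ i + 2 × b ≡ 0) ⊎ (a ≡ i + 2 × b ≡ i + 1))

ΔEquations⇔ΔEdge : ∀ {i a b} → ΔEquations i a b ⇔ ΔEdge i a b
ΔEquations⇔ΔEdge = mk⇔ from to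
  where
  from : ∀ {i a b} → ΔEquations i a b → ΔEdge i a b
  from (inj₁ (inj₁ (refl , a≤i)))  = step _ a≤i
  from (inj₁ (inj₂ (refl , a<i)))  = skip _ a<i
  from (inj₂ (inj₁ (refl , refl))) = apex₁
  from (inj₂ (inj₂ (refl , refl))) = apex₂

  to : ∀ {i a b} → ΔEdge i a b → ΔEquations i a b
  to (step _ a≤i) = inj₁ (inj₁ (refl , a≤i))
  to (skip _ a<i) = inj₁ (inj₂ (refl , a<i))
  to apex₁        = inj₂ (inj₁ (refl , refl))
  to apex₂        = inj₂ (inj₂ (refl , refl))

ΔEdge? : ∀ i a b → Dec (ΔEdge i a b)
ΔEdge? i a b = map ΔEquations⇔ΔEdge
  (   ((b ≟ⁿ suc a ×-dec a ≤? i) ⊎-dec (b ≟ⁿ suc (suc a) ×-dec a <? i))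
   ⊎-dec ((a ≟ⁿ i + 2 ×-dec b ≟ⁿ 0) ⊎-dec (a ≟ⁿ i + 2 ×-dec b ≟ⁿ i + 1)))

Δ? : ∀ i → DecidableGraph (Δ i)
Δ? i v w = ΔEdge? i (toℕ v) (toℕ w) ⊎-dec ΔEdge? i (toℕ w) (toℕ v)

-- Vertices of Δᵢ are numbered 0 … i+2 as in Defs (v_j ↦ j ∸ 1).
-- Δ₂ has no representation: along the edge 1-2 and the non-edges 0-3, 1-4,
-- 2-4 the spread is at least 7, but the cut principle bounds it by the spread
-- along six edges, which is 6.
Δ₂-E Δ₂-N Δ₂-R : Pairs 5
Δ₂-E = (# 1 , # 2) ∷ []
Δ₂-N = (# 0 , # 3) ∷ (# 1 , # 4) ∷ (# 2 , # 4) ∷ []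
Δ₂-R = (# 0 , # 2) ∷ (# 0 , # 4) ∷ (# 1 , # 0) ∷ (# 1 , # 3) ∷ (# 2 , # 3) ∷ (# 3 , # 4) ∷ []

Δ₂-cutConditions : CutConditions (Δ 2) Δ₂-E Δ₂-N Δ₂-R
Δ₂-cutConditions = from-yes (cutConditions? (Δ? 2) Δ₂-E Δ₂-N Δ₂-R)

-- Δ₄ has no representation: the spread along five non-edges is at least 10,
-- but the cut principle bounds it by the spread along nine edges.
Δ₄-N Δ₄-R : Pairs 7
Δ₄-N = (# 0 , # 3) ∷ (# 1 , # 4) ∷ (# 1 , # 6) ∷ (# 2 , # 5) ∷ (# 4 , # 6) ∷ []
Δ₄-R = (# 0 , # 2) ∷ (# 0 , # 6) ∷ (# 1 , # 0) ∷ (# 1 , # 3) ∷ (# 2 , # 3)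
     ∷ (# 2 , # 4) ∷ (# 3 , # 5) ∷ (# 4 , # 5) ∷ (# 5 , # 6) ∷ []

Δ₄-cutConditions : CutConditions (Δ 4) [] Δ₄-N Δ₄-R
Δ₄-cutConditions = from-yes (cutConditions? (Δ? 4) [] Δ₄-N Δ₄-R)

Δ₃-sets : Fin 6 → Subset 5
Δ₃-sets = lookup
  (   ⁅ # 0 ⁆ ∪ ⁅ # 1 ⁆
    ∷ ⁅ # 0 ⁆ ∪ ⁅ # 2 ⁆
    ∷ ⁅ # 0 ⁆ ∪ ⁅ # 3 ⁆
    ∷ ⁅ # 2 ⁆ ∪ ⁅ # 3 ⁆
    ∷ ⁅ # 3 ⁆ ∪ ⁅ # 4 ⁆
    ∷ ⁅ # 1 ⁆ ∪ ⁅ # 4 ⁆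
    ∷ [])

Δ₃-representation : IsJohnsonRepresentation (Δ 3) 2 Δ₃-sets
Δ₃-representation = from-yes (representation? (Δ? 3) 2 Δ₃-sets)

Δ₅-sets : Fin 8 → Subset 6
Δ₅-sets = lookup
  (   ⁅ # 0 ⁆ ∪ ⁅ # 1 ⁆ ∪ ⁅ # 2 ⁆
    ∷ ⁅ # 0 ⁆ ∪ ⁅ # 1 ⁆ ∪ ⁅ # 3 ⁆
    ∷ ⁅ # 0 ⁆ ∪ ⁅ # 1 ⁆ ∪ ⁅ # 4 ⁆
    ∷ ⁅ # 0 ⁆ ∪ ⁅ # 3 ⁆ ∪ ⁅ # 4 ⁆
    ∷ ⁅ # 0 ⁆ ∪ ⁅ # 4 ⁆ ∪ ⁅ # 5 ⁆
    ∷ ⁅ # 3 ⁆ ∪ ⁅ # 4 ⁆ ∪ ⁅ # 5 ⁆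
    ∷ ⁅ # 2 ⁆ ∪ ⁅ # 4 ⁆ ∪ ⁅ # 5 ⁆
    ∷ ⁅ # 1 ⁆ ∪ ⁅ # 2 ⁆ ∪ ⁅ # 5 ⁆
    ∷ [])

Δ₅-representation : IsJohnsonRepresentation (Δ 5) 3 Δ₅-sets
Δ₅-representation = from-yes (representation? (Δ? 5) 3 Δ₅-sets)

proposition9 : (¬ IsJIS (Δ 2) × ¬ IsJIS (Δ 4)) × (IsJIS (Δ 3) × IsJIS (Δ 5))
proposition9 =
  ( cutConditions⇒¬JIS Δ₂-E Δ₂-N Δ₂-R Δ₂-cutConditions
  , cutConditions⇒¬JIS [] Δ₄-N Δ₄-R Δ₄-cutConditions )
  , ( (2 , 5 , Δ₃-sets , Δ₃-representation)
    , (3 , 6 , Δ₅-sets , Δ₅-representation) )
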